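{- Let $u_n$ be the number of $DU_k$-equivalence classes of the set $\mathcal{L}_n$ of Łukasiewicz paths of length $n$. Then $$\sum_{n\geq0}u_nx^n=\frac{1-x-x^2-2x^3+\sqrt{1-2x-x^2-2x^3+x^4}}{1-2x-x^3+(1-x)\sqrt{1-2x-x^2-2x^3+x^4}},$$ and $u_0=u_1=u_2=1$ and $u_n=a_{n-1}$ for $n\geq 3$, where $a_0=1$ and $a_{m+1}=a_m+\sum_{k=1}^{m-1}a_ka_{m-1-k}$ for $m\geq0$.
   Context: A Łukasiewicz path of length $n$ is a sequence of $n$ steps from $\{(1,i): i\geq -1\}$ starting at $(0,0)$, ending at $(n,0)$ and never going below the $x$-axis. Write $D=(1,-1)$, $F=(1,0)$, $U_k=(1,k)$ for $k\geq1$. Steps are numbered $1,\dots,n$; an occurrence of $DU_k$ is at position $i$ if its $D$ is the $i$-th step. Two Łukasiewicz paths of the same length are $DU_k$-equivalent if for every $k\geq1$ the set of occurrence positions of $DU_k$ is the same in both. -}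

module Defs where

open import Data.Nat as ℕ using (ℕ; zero; suc; _≤_; _∸_)
open import Data.Integer as ℤ using (ℤ; +_; -[1+_])
open import Data.Rational as ℚ using (ℚ; 0ℚ; 1ℚ; _/_)
open import Data.List using (List; []; _∷_; _++_; length; map; upTo; drop)
open import Data.Nat.ListAction using (sum)
open import Data.List.Relation.Unary.All using (All)
open import Data.List.Relation.Unary.Any using (Any)
open import Data.List.Relation.Unary.AllPairs using (AllPairs)
open import Data.Product using (Σ; _×_; ∃₂)
open import Relation.Binary.PropositionalEquality using (_≡_)
open import Relation.Nullary using (¬_)
open import Function.Bundles using (_⇔_)

-- Łukasiewicz paths.  A path is the list of the y-increments of its
-- steps (all steps have x-increment 1):  D = -1, F = 0, U_k = k.

PathFrom : ℤ → List ℤ → Set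
PathFrom h []       = h ≡ + 0
PathFrom h (s ∷ ss) = (-[1+ 0 ] ℤ.≤ s) × (+ 0 ℤ.≤ h ℤ.+ s) × PathFrom (h ℤ.+ s) ss

Luk : ℕ → List ℤ → Set
Luk n p = (length p ≡ n) × PathFrom (+ 0) p

-- An occurrence of D U_k at position i (1-indexed: its D is the i-th step).
OccAt : ℕ → ℕ → List ℤ → Set
OccAt k i p = ∃₂ λ (pre post : List ℤ) →
  (p ≡ pre ++ (-[1+ 0 ] ∷ + k ∷ post)) × (suc (length pre) ≡ i)

DUEquiv : List ℤ → List ℤ → Set
DUEquiv p q = ∀ k → 1 ≤ k → ∀ i → OccAt k i p ⇔ OccAt k i q

NumClasses : ℕ → ℕ → Set
NumClasses n m = Σ (List (List ℤ)) λ reps →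
  (length reps ≡ m) × All (Luk n) reps ×
  AllPairs (λ p q → ¬ DUEquiv p q) reps ×
  (∀ p → Luk n p → Any (DUEquiv p) reps)

-- Σ_{k=1}^{m-1} f k   (empty for m ≤ 1); upTo m = [0, …, m-1]
sum1to : ℕ → (ℕ → ℕ) → ℕ
sum1to m f = sum (map f (drop 1 (upTo m)))

IsA : (ℕ → ℕ) → Set
IsA a = (a 0 ≡ 1) ×
  (∀ m → a (suc m) ≡ a m ℕ.+ sum1to m (λ k → a k ℕ.* a (m ∸ 1 ∸ k)))

Series : Set
Series = ℕ → ℚ

ι : ℤ → ℚ
ι z = z / 1

-- polynomial with given coefficient list (constant term first)
poly : List ℤ → Series
poly []       n       = 0ℚ
poly (c ∷ cs) zero    = ι c
poly (c ∷ cs) (suc n) = poly cs n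

_⊕_ : Series → Series → Series
(f ⊕ g) n = f n ℚ.+ g n

sumℚ : ℕ → (ℕ → ℚ) → ℚ
sumℚ zero    f = f 0
sumℚ (suc n) f = sumℚ n f ℚ.+ f (suc n)

_⊛_ : Series → Series → Series
(f ⊛ g) n = sumℚ n (λ i → f i ℚ.* g (n ∸ i))

ofℕ : (ℕ → ℕ) → Series
ofℕ u n = ι (+ u n)

-- 1 - 2x - x^2 - 2x^3 + x^4
Δ : Series
Δ = poly (+ 1 ∷ -[1+ 1 ] ∷ -[1+ 0 ] ∷ -[1+ 1 ] ∷ + 1 ∷ [])

IsSqrtΔ : Series → Set
IsSqrtΔ S = (S 0 ≡ 1ℚ) × (∀ n → (S ⊛ S) n ≡ Δ n)

-- numerator  1 - x - x^2 - 2x^3 + √Δ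
Num : Series → Series
Num S = poly (+ 1 ∷ -[1+ 0 ] ∷ -[1+ 0 ] ∷ -[1+ 1 ] ∷ []) ⊕ S

-- denominator  1 - 2x - x^3 + (1 - x) √Δ
Den : Series → Series
Den S = poly (+ 1 ∷ -[1+ 1 ] ∷ + 0 ∷ -[1+ 0 ] ∷ []) ⊕ (poly (+ 1 ∷ -[1+ 0 ] ∷ []) ⊛ S)

-- Σ u_n x^n = Num / Den, stated as  (Σ u_n x^n) · Den = Num
-- (Den has constant term 2, so it is invertible and this is equivalent).
GFIdentity : (ℕ → ℕ) → Set
GFIdentity u = ∀ S → IsSqrtΔ S → ∀ n → (ofℕ u ⊛ Den S) n ≡ Num S n

module Submission where

-- The DU_k-equivalence class of a path is determined by its profile, the list giving for each
-- position the k of the DU_k occurring there (0 if none).  Profiles are described by words in two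
-- kinds of blocks, a free step and an occurrence of DU_{1+j}; those arising from paths are the
-- feasible words (a height condition) preceded by one free step, since a path cannot start with D.
-- A feasible word starting with DU_{1+j} is uniquely DU_{1+j} w₁ w₂ with w₁ nonempty feasible and
-- w₂ feasible of top j, which gives a_{m+1} = a_m + Σ_{k=1}^{m-1} a_k a_{m-1-k} for the number a_m
-- of feasible words of weight m, and u_{m+1} = a_m.
--
-- For A = Σ a_m x^m the recursion reads A = 1 + x(A + x(A² − A)).  Hence (1 − x + x² − 2x²A)² = Δ,
-- so this series is √Δ (a square root with constant term 1 is unique), and then
-- (1 + xA)·Den − Num = −2x(1 − x)(1 + x(A + x(A² − A)) − A) = 0.

open import Defs
open import Data.Nat using (ℕ; zero; suc; _≤_; _∸_)
open import Data.Product using (Σ; _×_; _,_)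
open import Relation.Binary.PropositionalEquality using (_≡_; refl)

module PowerSeries where

  open import Level using (0ℓ)
  open import Data.Nat as ℕ using (z≤n; s≤s)
  import Data.Nat.Properties as ℕP
  open import Data.Nat.ListAction using (sum)
  open import Data.Integer as ℤ using (ℤ; +_; -[1+_])
  import Data.Integer.Properties as ℤP
  open import Data.Rational as ℚ using (ℚ; 0ℚ; 1ℚ; mkℚ)
  import Data.Rational.Properties as ℚP
  open import Data.Rational.Solver using (module +-*-Solver)
  import Data.Nat.Coprimality as Coprimality
  open import Data.List using (List; []; _∷_; map; applyUpTo)
  open import Data.Maybe using (just; nothing)
  open import Data.Product using (proj₁; proj₂)
  open import Data.Sum using (inj₁; inj₂)
  open import Function using (_∘_)
  open import Algebra.Bundles using (CommutativeRing)
  import Algebra.Construct.Pointwise as Pointwise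
  import Algebra.Properties.AbelianGroup as AbelianGroupProperties
  open import Algebra.Solver.Ring.AlmostCommutativeRing
    using (fromCommutativeRing; _-Raw-AlmostCommutative⟶_; Induced-equivalence)
  import Algebra.Solver.Ring
  open import Relation.Binary.Definitions using (WeaklyDecidable)
  open import Relation.Nullary using (yes; no)
  open import Relation.Binary.PropositionalEquality hiding (setoid)
  import Relation.Binary.Reasoning.Setoid as SetoidReasoning

  sumℚ-cong : ∀ n {f g : ℕ → ℚ} → (∀ i → i ≤ n → f i ≡ g i) → sumℚ n f ≡ sumℚ n g
  sumℚ-cong zero    f≡g = f≡g 0 z≤n
  sumℚ-cong (suc n) f≡g =
    cong₂ ℚ._+_ (sumℚ-cong n (λ i i≤n → f≡g i (ℕP.m≤n⇒m≤1+n i≤n))) (f≡g (suc n) ℕP.≤-refl)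

  sumℚ-unconsˡ : ∀ n (f : ℕ → ℚ) → sumℚ (suc n) f ≡ f 0 ℚ.+ sumℚ n (f ∘ suc)
  sumℚ-unconsˡ zero    f = refl
  sumℚ-unconsˡ (suc n) f = begin
    sumℚ (suc n) f ℚ.+ f (suc (suc n))
      ≡⟨ cong (ℚ._+ f (suc (suc n))) (sumℚ-unconsˡ n f) ⟩
    (f 0 ℚ.+ sumℚ n (f ∘ suc)) ℚ.+ f (suc (suc n))
      ≡⟨ ℚP.+-assoc (f 0) _ _ ⟩
    f 0 ℚ.+ sumℚ (suc n) (f ∘ suc) ∎
    where open ≡-Reasoning

  sumℚ-+ : ∀ n (f g : ℕ → ℚ) → sumℚ n (λ i → f i ℚ.+ g i) ≡ sumℚ n f ℚ.+ sumℚ n g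
  sumℚ-+ zero    f g = refl
  sumℚ-+ (suc n) f g = trans (cong (ℚ._+ (f (suc n) ℚ.+ g (suc n))) (sumℚ-+ n f g))
    (solve 4 (λ a b c d → (a :+ b) :+ (c :+ d) := (a :+ c) :+ (b :+ d)) refl
      (sumℚ n f) (sumℚ n g) (f (suc n)) (g (suc n)))
    where open +-*-Solver

  sumℚ-*ˡ : ∀ n c (f : ℕ → ℚ) → sumℚ n (λ i → c ℚ.* f i) ≡ c ℚ.* sumℚ n f
  sumℚ-*ˡ zero    c f = refl
  sumℚ-*ˡ (suc n) c f = trans (cong (ℚ._+ c ℚ.* f (suc n)) (sumℚ-*ˡ n c f))
    (sym (ℚP.*-distribˡ-+ c (sumℚ n f) (f (suc n))))

  sumℚ-zero : ∀ n → sumℚ n (λ _ → 0ℚ) ≡ 0ℚ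
  sumℚ-zero zero    = refl
  sumℚ-zero (suc n) = cong (ℚ._+ 0ℚ) (sumℚ-zero n)

  sumℚ-reverse : ∀ n (f : ℕ → ℚ) → sumℚ n f ≡ sumℚ n (λ i → f (n ∸ i))
  sumℚ-reverse zero    f = refl
  sumℚ-reverse (suc n) f = begin
    sumℚ n f ℚ.+ f (suc n)                      ≡⟨ cong (ℚ._+ f (suc n)) (sumℚ-reverse n f) ⟩
    sumℚ n (λ i → f (n ∸ i)) ℚ.+ f (suc n)      ≡⟨ ℚP.+-comm _ (f (suc n)) ⟩
    f (suc n) ℚ.+ sumℚ n (λ i → f (n ∸ i))      ≡⟨ sumℚ-unconsˡ n (λ i → f (suc n ∸ i)) ⟨
    sumℚ (suc n) (λ i → f (suc n ∸ i))          ∎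
    where open ≡-Reasoning

  infix 4 _≈_
  _≈_ : Series → Series → Set
  _≈_ = _≗_

  0ₛ : Series
  0ₛ _ = 0ℚ

  ⊝_ : Series → Series
  (⊝ f) n = ℚ.- f n

  κ : ℚ → Series
  κ q zero    = q
  κ q (suc n) = 0ℚ

  1ₛ : Series
  1ₛ = κ 1ℚ

  ⊛-cong : ∀ {f f′ g g′} → f ≈ f′ → g ≈ g′ → f ⊛ g ≈ f′ ⊛ g′
  ⊛-cong f≈f′ g≈g′ n = sumℚ-cong n (λ i _ → cong₂ ℚ._*_ (f≈f′ i) (g≈g′ (n ∸ i)))

  ⊛-comm : ∀ f g → f ⊛ g ≈ g ⊛ f
  ⊛-comm f g n = trans (sumℚ-reverse n _) (sumℚ-cong n λ i i≤n →
    trans (cong (λ j → f (n ∸ i) ℚ.* g j) (ℕP.m∸[m∸n]≡n i≤n)) (ℚP.*-comm (f (n ∸ i)) (g i)))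

  ⊛-unconsˡ : ∀ f g n → (f ⊛ g) (suc n) ≡ f 0 ℚ.* g (suc n) ℚ.+ ((f ∘ suc) ⊛ g) n
  ⊛-unconsˡ f g n = sumℚ-unconsˡ n (λ i → f i ℚ.* g (suc n ∸ i))

  ⊛-distribʳ : ∀ h f g → (f ⊕ g) ⊛ h ≈ (f ⊛ h) ⊕ (g ⊛ h)
  ⊛-distribʳ h f g n = trans (sumℚ-cong n (λ i _ → ℚP.*-distribʳ-+ (h (n ∸ i)) (f i) (g i)))
    (sumℚ-+ n (λ i → f i ℚ.* h (n ∸ i)) (λ i → g i ℚ.* h (n ∸ i)))

  ⊛-distribˡ : ∀ h f g → h ⊛ (f ⊕ g) ≈ (h ⊛ f) ⊕ (h ⊛ g)
  ⊛-distribˡ h f g n = begin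
    (h ⊛ (f ⊕ g)) n             ≡⟨ ⊛-comm h (f ⊕ g) n ⟩
    ((f ⊕ g) ⊛ h) n             ≡⟨ ⊛-distribʳ h f g n ⟩
    (f ⊛ h) n ℚ.+ (g ⊛ h) n     ≡⟨ cong₂ ℚ._+_ (⊛-comm f h n) (⊛-comm g h n) ⟩
    (h ⊛ f) n ℚ.+ (h ⊛ g) n     ∎
    where open ≡-Reasoning

  ⊛-*ˡ : ∀ c f g → (λ i → c ℚ.* f i) ⊛ g ≈ λ n → c ℚ.* (f ⊛ g) n
  ⊛-*ˡ c f g n = trans (sumℚ-cong n (λ i _ → ℚP.*-assoc c (f i) (g (n ∸ i))))
    (sumℚ-*ˡ n c (λ i → f i ℚ.* g (n ∸ i)))

  ⊛-zeroˡ : ∀ g → 0ₛ ⊛ g ≈ 0ₛ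
  ⊛-zeroˡ g n = trans (sumℚ-cong n (λ i _ → ℚP.*-zeroˡ (g (n ∸ i)))) (sumℚ-zero n)

  ⊛-identityˡ : ∀ g → 1ₛ ⊛ g ≈ g
  ⊛-identityˡ g zero    = ℚP.*-identityˡ (g 0)
  ⊛-identityˡ g (suc n) = begin
    (1ₛ ⊛ g) (suc n)                       ≡⟨ ⊛-unconsˡ 1ₛ g n ⟩
    1ℚ ℚ.* g (suc n) ℚ.+ (0ₛ ⊛ g) n        ≡⟨ cong₂ ℚ._+_ (ℚP.*-identityˡ (g (suc n))) (⊛-zeroˡ g n) ⟩
    g (suc n) ℚ.+ 0ℚ                       ≡⟨ ℚP.+-identityʳ (g (suc n)) ⟩
    g (suc n)                              ∎
    where open ≡-Reasoning

  ⊛-identityʳ : ∀ g → g ⊛ 1ₛ ≈ g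
  ⊛-identityʳ g n = trans (⊛-comm g 1ₛ n) (⊛-identityˡ g n)

  ⊛-assoc : ∀ f g h → (f ⊛ g) ⊛ h ≈ f ⊛ (g ⊛ h)
  ⊛-assoc f g h zero    = ℚP.*-assoc (f 0) (g 0) (h 0)
  ⊛-assoc f g h (suc n) = begin
    ((f ⊛ g) ⊛ h) (suc n)
      ≡⟨ ⊛-unconsˡ (f ⊛ g) h n ⟩
    f₀ ℚ.* g 0 ℚ.* h (suc n) ℚ.+ (((f ⊛ g) ∘ suc) ⊛ h) n
      ≡⟨ cong (f₀ ℚ.* g 0 ℚ.* h (suc n) ℚ.+_) (⊛-cong {g = h} (⊛-unconsˡ f g) (λ _ → refl) n) ⟩
    f₀ ℚ.* g 0 ℚ.* h (suc n) ℚ.+ (((λ i → f₀ ℚ.* g (suc i)) ⊕ ((f ∘ suc) ⊛ g)) ⊛ h) n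
      ≡⟨ cong (f₀ ℚ.* g 0 ℚ.* h (suc n) ℚ.+_)
           (trans (⊛-distribʳ h (λ i → f₀ ℚ.* g (suc i)) ((f ∘ suc) ⊛ g) n)
                  (cong₂ ℚ._+_ (⊛-*ˡ f₀ (g ∘ suc) h n) (⊛-assoc (f ∘ suc) g h n))) ⟩
    f₀ ℚ.* g 0 ℚ.* h (suc n) ℚ.+ (f₀ ℚ.* ((g ∘ suc) ⊛ h) n ℚ.+ ((f ∘ suc) ⊛ (g ⊛ h)) n)
      ≡⟨ solve 5 (λ a b c d e → a :* b :* c :+ (a :* d :+ e) := a :* (b :* c :+ d) :+ e) refl
           f₀ (g 0) (h (suc n)) (((g ∘ suc) ⊛ h) n) (((f ∘ suc) ⊛ (g ⊛ h)) n) ⟩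
    f₀ ℚ.* (g 0 ℚ.* h (suc n) ℚ.+ ((g ∘ suc) ⊛ h) n) ℚ.+ ((f ∘ suc) ⊛ (g ⊛ h)) n
      ≡⟨ cong (λ c → f₀ ℚ.* c ℚ.+ ((f ∘ suc) ⊛ (g ⊛ h)) n) (⊛-unconsˡ g h n) ⟨
    f₀ ℚ.* (g ⊛ h) (suc n) ℚ.+ ((f ∘ suc) ⊛ (g ⊛ h)) n
      ≡⟨ ⊛-unconsˡ f (g ⊛ h) n ⟨
    (f ⊛ (g ⊛ h)) (suc n) ∎
    where
    open ≡-Reasoning
    open +-*-Solver
    f₀ : ℚ
    f₀ = f 0

  seriesRing : CommutativeRing 0ℓ 0ℓ
  seriesRing = record
    { Carrier = Series
    ; _≈_ = _≈_
    ; _+_ = _⊕_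
    ; _*_ = _⊛_
    ; -_  = ⊝_
    ; 0#  = 0ₛ
    ; 1#  = 1ₛ
    ; isCommutativeRing = record
      { isRing = record
        { +-isAbelianGroup = Pointwise.isAbelianGroup ℕ ℚP.+-0-isAbelianGroup
        ; *-cong     = ⊛-cong
        ; *-assoc    = ⊛-assoc
        ; *-identity = ⊛-identityˡ , ⊛-identityʳ
        ; distrib    = ⊛-distribˡ , ⊛-distribʳ
        }
      ; *-comm = ⊛-comm
      }
    }

  κ-homomorphism : ℚ.+-*-rawRing -Raw-AlmostCommutative⟶ fromCommutativeRing seriesRing
  κ-homomorphism = record
    { ⟦_⟧    = κ
    ; +-homo = λ { p q zero → refl ; p q (suc n) → refl }
    ; *-homo = *-homo
    ; -‿homo = λ { p zero → refl ; p (suc n) → refl }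
    ; 0-homo = λ { zero → refl ; (suc n) → refl }
    ; 1-homo = λ _ → refl
    }
    where
    *-homo : ∀ p q → κ (p ℚ.* q) ≈ κ p ⊛ κ q
    *-homo p q zero    = refl
    *-homo p q (suc n) = sym (begin
      (κ p ⊛ κ q) (suc n)              ≡⟨ ⊛-unconsˡ (κ p) (κ q) n ⟩
      p ℚ.* 0ℚ ℚ.+ (0ₛ ⊛ κ q) n        ≡⟨ cong₂ ℚ._+_ (ℚP.*-zeroʳ p) (⊛-zeroˡ (κ q) n) ⟩
      0ℚ                               ∎)
      where open ≡-Reasoning

  κ-≟ : WeaklyDecidable (Induced-equivalence κ-homomorphism)
  κ-≟ p q with p ℚ.≟ q
  ... | yes refl = just (λ _ → refl)
  ... | no _     = nothing

  module SeriesSolver =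
    Algebra.Solver.Ring ℚ.+-*-rawRing (fromCommutativeRing seriesRing) κ-homomorphism κ-≟

  open CommutativeRing seriesRing
    using (_+_; _*_; _-_; -_; setoid; +-cong; +-congˡ; *-cong; +-identityˡ; +-identityʳ; zeroʳ; -‿inverseʳ)
    renaming (refl to ≈-refl; sym to ≈-sym; trans to ≈-trans)

  X : Series
  X zero    = 0ℚ
  X (suc n) = 1ₛ n

  X*-zero : ∀ f → (X * f) 0 ≡ 0ℚ
  X*-zero f = ℚP.*-zeroˡ (f 0)

  X*-suc : ∀ f n → (X * f) (suc n) ≡ f n
  X*-suc f n = begin
    (X * f) (suc n)                   ≡⟨ ⊛-unconsˡ X f n ⟩
    0ℚ ℚ.* f (suc n) ℚ.+ (1ₛ ⊛ f) n   ≡⟨ cong₂ ℚ._+_ (ℚP.*-zeroˡ (f (suc n))) (⊛-identityˡ f n) ⟩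
    0ℚ ℚ.+ f n                        ≡⟨ ℚP.+-identityˡ (f n) ⟩
    f n                               ∎
    where open ≡-Reasoning

  open SeriesSolver using (Polynomial; solve; _:=_; con; _:+_; _:*_; _:-_)

  κ+X*-zero : ∀ c g → (κ c + X * g) 0 ≡ c
  κ+X*-zero c g = trans (cong (c ℚ.+_) (X*-zero g)) (ℚP.+-identityʳ c)

  κ+X*-suc : ∀ c g n → (κ c + X * g) (suc n) ≡ g n
  κ+X*-suc c g n = trans (cong (0ℚ ℚ.+_) (X*-suc g n)) (ℚP.+-identityˡ (g n))

  horner : List ℤ → Series
  horner []       = κ 0ℚ
  horner (c ∷ cs) = κ (ι c) + X * horner cs

  hornerₚ : ∀ {n} → Polynomial n → List ℤ → Polynomial n
  hornerₚ x []       = con 0ℚ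
  hornerₚ x (c ∷ cs) = con (ι c) :+ x :* hornerₚ x cs

  poly≈horner : ∀ cs → poly cs ≈ horner cs
  poly≈horner []       zero    = refl
  poly≈horner []       (suc n) = refl
  poly≈horner (c ∷ cs) zero    = sym (κ+X*-zero (ι c) (horner cs))
  poly≈horner (c ∷ cs) (suc n) = trans (poly≈horner cs n) (sym (κ+X*-suc (ι c) (horner cs) n))

  +-multiple-of-zero : ∀ p q {e} → e ≈ 0ₛ → p + q * e ≈ p
  +-multiple-of-zero p q {e} e≈0 = begin
    p + q * e     ≈⟨ +-congˡ {p} (*-cong {q} ≈-refl e≈0) ⟩
    p + q * 0ₛ    ≈⟨ +-congˡ {p} (zeroʳ q) ⟩
    p + 0ₛ        ≈⟨ +-identityʳ p ⟩
    p             ∎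
    where open SetoidReasoning setoid

  *-cancelʳ-zero : ∀ {f g} → g 0 ≢ 0ℚ → f * g ≈ 0ₛ → f ≈ 0ₛ
  *-cancelʳ-zero {f} {g} g₀≢0 fg≈0 n = vanishes n n ℕP.≤-refl
    where
    cancel : ∀ {x} → x ℚ.* g 0 ≡ 0ℚ → x ≡ 0ℚ
    cancel {x} xg₀≡0 = begin
      x                              ≡⟨ ℚP.*-identityʳ x ⟨
      x ℚ.* 1ℚ                       ≡⟨ cong (x ℚ.*_) (ℚP.*-inverseʳ (g 0)) ⟨
      x ℚ.* (g 0 ℚ.* ℚ.1/ g 0)       ≡⟨ ℚP.*-assoc x (g 0) (ℚ.1/ g 0) ⟨
      x ℚ.* g 0 ℚ.* ℚ.1/ g 0         ≡⟨ cong (ℚ._* ℚ.1/ g 0) xg₀≡0 ⟩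
      0ℚ ℚ.* ℚ.1/ g 0                ≡⟨ ℚP.*-zeroˡ (ℚ.1/ g 0) ⟩
      0ℚ                             ∎
      where
      open ≡-Reasoning
      instance
        g₀-nonZero : ℚ.NonZero (g 0)
        g₀-nonZero = ℚ.≢-nonZero g₀≢0
    leading : ∀ n → (∀ i → i ≤ n → f i ≡ 0ℚ) → f (suc n) ℚ.* g 0 ≡ 0ℚ
    leading n low = begin
      f (suc n) ℚ.* g 0
        ≡⟨ ℚP.+-identityˡ (f (suc n) ℚ.* g 0) ⟨
      0ℚ ℚ.+ f (suc n) ℚ.* g 0
        ≡⟨ cong₂ ℚ._+_ lower (cong (λ j → f (suc n) ℚ.* g j) (ℕP.n∸n≡0 n)) ⟨
      sumℚ n (λ i → f i ℚ.* g (suc n ∸ i)) ℚ.+ f (suc n) ℚ.* g (n ∸ n)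
        ≡⟨ fg≈0 (suc n) ⟩
      0ℚ ∎
      where
      open ≡-Reasoning
      lower : sumℚ n (λ i → f i ℚ.* g (suc n ∸ i)) ≡ 0ℚ
      lower = trans (sumℚ-cong n λ i i≤n → trans (cong (ℚ._* g (suc n ∸ i)) (low i i≤n))
                                                  (ℚP.*-zeroˡ (g (suc n ∸ i))))
                    (sumℚ-zero n)
    vanishes : ∀ n i → i ≤ n → f i ≡ 0ℚ
    vanishes zero    .0 z≤n = cancel (fg≈0 0)
    vanishes (suc n) i i≤1+n with ℕP.m≤n⇒m<n∨m≡n i≤1+n
    ... | inj₁ (s≤s i≤n) = vanishes n i i≤n
    ... | inj₂ refl      = cancel (leading n (vanishes n))

  square-root-unique : ∀ {S T} → S 0 ≡ 1ℚ → T 0 ≡ 1ℚ → S * S ≈ T * T → S ≈ T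
  square-root-unique {S} {T} S₀≡1 T₀≡1 S²≈T² = begin
    S                     ≈⟨ solve 2 (λ s t → s := (s :- t) :+ t) (λ _ → refl) S T ⟩
    (S - T) + T           ≈⟨ +-cong difference≈0 ≈-refl ⟩
    0ₛ + T                ≈⟨ +-identityˡ T ⟩
    T                     ∎
    where
    open SetoidReasoning setoid
    sum₀≢0 : (S + T) 0 ≢ 0ℚ
    sum₀≢0 eq with trans (sym (cong₂ ℚ._+_ S₀≡1 T₀≡1)) eq
    ... | ()
    product≈0 : (S - T) * (S + T) ≈ 0ₛ
    product≈0 = begin
      (S - T) * (S + T)   ≈⟨ solve 2 (λ s t → (s :- t) :* (s :+ t) := s :* s :- t :* t) (λ _ → refl) S T ⟩
      S * S - T * T       ≈⟨ +-cong S²≈T² ≈-refl ⟩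
      T * T - T * T       ≈⟨ -‿inverseʳ (T * T) ⟩
      0ₛ                  ∎
    difference≈0 : S - T ≈ 0ₛ
    difference≈0 = *-cancelʳ-zero {S - T} {S + T} sum₀≢0 product≈0

  ι-canonical : ∀ n → ι (+ n) ≡ mkℚ (+ n) 0 (Coprimality.sym (Coprimality.1-coprimeTo n))
  ι-canonical n = ℚP.normalize-coprime _

  ι-+ : ∀ m n → ι (+ (m ℕ.+ n)) ≡ ι (+ m) ℚ.+ ι (+ n)
  ι-+ m n = sym (trans (cong₂ ℚ._+_ (ι-canonical m) (ι-canonical n))
    (ℚP./-cong {p₂ = + (m ℕ.+ n)}
      (trans (cong₂ ℤ._+_ (ℤP.*-identityʳ (+ m)) (ℤP.*-identityʳ (+ n))) (sym (ℤP.pos-+ m n))) refl))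

  ι-* : ∀ m n → ι (+ (m ℕ.* n)) ≡ ι (+ m) ℚ.* ι (+ n)
  ι-* m n = sym (trans (cong₂ ℚ._*_ (ι-canonical m) (ι-canonical n))
    (ℚP./-cong {p₂ = + (m ℕ.* n)} (sym (ℤP.pos-* m n)) refl))

  ι-sum-applyUpTo : ∀ (f h : ℕ → ℕ) n →
                    ι (+ sum (map f (applyUpTo h (suc n)))) ≡ sumℚ n (λ i → ι (+ f (h i)))
  ι-sum-applyUpTo f h zero    = cong (ι ∘ +_) (ℕP.+-identityʳ (f (h 0)))
  ι-sum-applyUpTo f h (suc n) = begin
    ι (+ (f (h 0) ℕ.+ sum (map f (applyUpTo (h ∘ suc) (suc n)))))
      ≡⟨ ι-+ (f (h 0)) _ ⟩
    ι (+ f (h 0)) ℚ.+ ι (+ sum (map f (applyUpTo (h ∘ suc) (suc n))))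
      ≡⟨ cong (ι (+ f (h 0)) ℚ.+_) (ι-sum-applyUpTo f (h ∘ suc) n) ⟩
    ι (+ f (h 0)) ℚ.+ sumℚ n (λ i → ι (+ f (h (suc i))))
      ≡⟨ sumℚ-unconsˡ n (λ i → ι (+ f (h i))) ⟨
    sumℚ (suc n) (λ i → ι (+ f (h i))) ∎
    where open ≡-Reasoning

  √Δₚ : ∀ {n} → Polynomial n → Polynomial n → Polynomial n
  √Δₚ x y = con 1ℚ :- x :+ x :* x :- con (ι (+ 2)) :* x :* x :* y

  defectₚ : ∀ {n} → Polynomial n → Polynomial n → Polynomial n
  defectₚ x y = con 1ℚ :+ x :* (y :+ x :* (y :* y :- y)) :- y

  Δ-coefficients numerator-coefficients denominator-coefficients one-minus-x : List ℤ
  Δ-coefficients           = + 1 ∷ -[1+ 1 ] ∷ -[1+ 0 ] ∷ -[1+ 1 ] ∷ + 1 ∷ []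
  numerator-coefficients   = + 1 ∷ -[1+ 0 ] ∷ -[1+ 0 ] ∷ -[1+ 1 ] ∷ []
  denominator-coefficients = + 1 ∷ -[1+ 1 ] ∷ + 0 ∷ -[1+ 0 ] ∷ []
  one-minus-x              = + 1 ∷ -[1+ 0 ] ∷ []

  module ℚ+-group = AbelianGroupProperties ℚP.+-0-abelianGroup

  module _ (a : ℕ → ℕ) (isA : IsA a) where

    private
      A : Series
      A = ofℕ a

    A₀≡1 : A 0 ≡ 1ℚ
    A₀≡1 = cong (ι ∘ +_) (proj₁ isA)

    A₁≡1 : A 1 ≡ 1ℚ
    A₁≡1 = cong (ι ∘ +_) (trans (proj₂ isA 0) (trans (ℕP.+-identityʳ (a 0)) (proj₁ isA)))

    -- The k = 0 term of [x^k] A² is a₀ a_k = a_k.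
    convolution-tail : ∀ k → ι (+ sum1to (suc k) (λ j → a j ℕ.* a (k ∸ j))) ≡ (A * A) k ℚ.- A k
    convolution-tail zero    = sym (cong (λ z → z ℚ.* z ℚ.- z) A₀≡1)
    convolution-tail (suc k) = begin
      ι (+ sum (map (λ j → a j ℕ.* a (suc k ∸ j)) (applyUpTo suc (suc k))))
        ≡⟨ ι-sum-applyUpTo (λ j → a j ℕ.* a (suc k ∸ j)) suc k ⟩
      sumℚ k (λ i → ι (+ (a (suc i) ℕ.* a (k ∸ i))))
        ≡⟨ sumℚ-cong k (λ i _ → ι-* (a (suc i)) (a (k ∸ i))) ⟩
      tail
        ≡⟨ ℚ+-group.xyx⁻¹≈y (A (suc k)) tail ⟨
      A (suc k) ℚ.+ tail ℚ.- A (suc k)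
        ≡⟨ cong (λ z → z ℚ.+ tail ℚ.- A (suc k)) (ℚP.*-identityˡ (A (suc k))) ⟨
      1ℚ ℚ.* A (suc k) ℚ.+ tail ℚ.- A (suc k)
        ≡⟨ cong (λ z → z ℚ.* A (suc k) ℚ.+ tail ℚ.- A (suc k)) A₀≡1 ⟨
      A 0 ℚ.* A (suc k) ℚ.+ tail ℚ.- A (suc k)
        ≡⟨ cong (ℚ._- A (suc k)) (⊛-unconsˡ A A k) ⟨
      (A * A) (suc k) ℚ.- A (suc k) ∎
      where
      open ≡-Reasoning
      tail : ℚ
      tail = sumℚ k (λ i → A (suc i) ℚ.* A (k ∸ i))

    A-fixpoint : A ≈ 1ₛ + X * (A + X * (A * A - A))
    A-fixpoint zero          = trans A₀≡1 (sym (κ+X*-zero 1ℚ (A + X * (A * A - A))))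
    A-fixpoint (suc zero)    = begin
      A 1                             ≡⟨ trans A₁≡1 (sym A₀≡1) ⟩
      A 0                             ≡⟨ ℚP.+-identityʳ (A 0) ⟨
      A 0 ℚ.+ 0ℚ                      ≡⟨ cong (A 0 ℚ.+_) (X*-zero (A * A - A)) ⟨
      (A + X * (A * A - A)) 0         ≡⟨ κ+X*-suc 1ℚ (A + X * (A * A - A)) 0 ⟨
      (1ₛ + X * (A + X * (A * A - A))) 1 ∎
      where open ≡-Reasoning
    A-fixpoint (suc (suc k)) = begin
      ι (+ a (2 ℕ.+ k))                                    ≡⟨ cong (ι ∘ +_) (proj₂ isA (suc k)) ⟩
      ι (+ (a (suc k) ℕ.+ sum1to (suc k) _))               ≡⟨ ι-+ (a (suc k)) _ ⟩
      A (suc k) ℚ.+ ι (+ sum1to (suc k) _)                 ≡⟨ cong (A (suc k) ℚ.+_) (convolution-tail k) ⟩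
      A (suc k) ℚ.+ (A * A - A) k                          ≡⟨ cong (A (suc k) ℚ.+_) (X*-suc (A * A - A) k) ⟨
      (A + X * (A * A - A)) (suc k)                        ≡⟨ κ+X*-suc 1ℚ (A + X * (A * A - A)) (suc k) ⟨
      (1ₛ + X * (A + X * (A * A - A))) (2 ℕ.+ k)           ∎
      where open ≡-Reasoning

    defect : Series
    defect = 1ₛ + X * (A + X * (A * A - A)) - A

    defect≈0 : defect ≈ 0ₛ
    defect≈0 n = trans (cong (ℚ._- A n) (sym (A-fixpoint n))) (ℚP.+-inverseʳ (A n))

    √Δ : Series
    √Δ = 1ₛ - X + X * X - κ (ι (+ 2)) * X * X * A

    √Δ₀≡1 : √Δ 0 ≡ 1ℚ
    √Δ₀≡1 = cong (λ z → 1ℚ ℚ.- 0ℚ ℚ.+ 0ℚ ℚ.* 0ℚ ℚ.- z) (ℚP.*-zeroˡ (A 0))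

    √Δ-squared : √Δ * √Δ ≈ Δ
    √Δ-squared = begin
      √Δ * √Δ
        ≈⟨ solve 2 (λ x y → √Δₚ x y :* √Δₚ x y
                         := hornerₚ x Δ-coefficients :+ con (ι (+ 4)) :* x :* x :* defectₚ x y)
             (λ _ → refl) X A ⟩
      horner Δ-coefficients + κ (ι (+ 4)) * X * X * defect
        ≈⟨ +-multiple-of-zero (horner Δ-coefficients) (κ (ι (+ 4)) * X * X) defect≈0 ⟩
      horner Δ-coefficients
        ≈⟨ ≈-sym (poly≈horner Δ-coefficients) ⟩
      Δ ∎
      where open SetoidReasoning setoid

    generating-function : ∀ u → u 0 ≡ 1 → (∀ m → u (suc m) ≡ a m) → GFIdentity u
    generating-function u u₀≡1 u-suc S (S₀≡1 , S²≈Δ) = begin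
      ofℕ u * Den S
        ≈⟨ *-cong u≈1+XA Den≈ ⟩
      (1ₛ + X * A) * (horner denominator-coefficients + horner one-minus-x * √Δ)
        ≈⟨ solve 2 (λ x y → (con 1ℚ :+ x :* y)
                             :* (hornerₚ x denominator-coefficients :+ hornerₚ x one-minus-x :* √Δₚ x y)
                         := (hornerₚ x numerator-coefficients :+ √Δₚ x y)
                             :+ con (ι -[1+ 1 ]) :* x :* (con 1ℚ :- x) :* defectₚ x y)
             (λ _ → refl) X A ⟩
      (horner numerator-coefficients + √Δ) + κ (ι -[1+ 1 ]) * X * (1ₛ - X) * defect
        ≈⟨ +-multiple-of-zero (horner numerator-coefficients + √Δ) (κ (ι -[1+ 1 ]) * X * (1ₛ - X))
             defect≈0 ⟩
      horner numerator-coefficients + √Δ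
        ≈⟨ ≈-sym (+-cong (poly≈horner numerator-coefficients) S≈√Δ) ⟩
      Num S ∎
      where
      open SetoidReasoning setoid
      S≈√Δ : S ≈ √Δ
      S≈√Δ = square-root-unique S₀≡1 √Δ₀≡1 (≈-trans S²≈Δ (≈-sym √Δ-squared))
      u≈1+XA : ofℕ u ≈ 1ₛ + X * A
      u≈1+XA zero    = trans (cong (ι ∘ +_) u₀≡1) (sym (κ+X*-zero 1ℚ A))
      u≈1+XA (suc m) = trans (cong (ι ∘ +_) (u-suc m)) (sym (κ+X*-suc 1ℚ A m))
      Den≈ : Den S ≈ horner denominator-coefficients + horner one-minus-x * √Δ
      Den≈ = +-cong (poly≈horner denominator-coefficients) (*-cong (poly≈horner one-minus-x) S≈√Δ)

module DUClasses where

  open import Data.Nat as ℕ using (pred; _+_; _*_; _<_; z≤n; s≤s)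
  import Data.Nat.Properties as ℕP
  open import Data.Nat.Induction using (<-rec)
  open import Data.Nat.ListAction using (sum)
  open import Data.Integer as ℤ using (ℤ; +_; -[1+_])
  open import Data.List
    using (List; []; _∷_; _++_; length; map; concat; concatMap; cartesianProductWith; drop; upTo)
  import Data.List.Properties as List
  open import Data.List.Relation.Unary.All as All using (All; []; _∷_)
  import Data.List.Relation.Unary.All.Properties as All
  open import Data.List.Relation.Unary.Any as Any using (Any; here; there)
  open import Data.List.Relation.Unary.AllPairs as AllPairs using (AllPairs; []; _∷_)
  import Data.List.Relation.Unary.AllPairs.Properties as AllPairs
  open import Data.List.Relation.Unary.Unique.Propositional using (Unique)
  import Data.List.Relation.Unary.Unique.Propositional.Properties as Unique
  open import Data.List.Relation.Binary.Disjoint.Propositional using (Disjoint)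
  open import Data.List.Membership.Propositional using (_∈_; find)
  open import Data.List.Membership.Propositional.Properties
    using (∈-map⁺; ∈-map⁻; ∈-++⁺ˡ; ∈-++⁺ʳ; ∈-++⁻; ∈-concatMap⁺; ∈-concatMap⁻;
           ∈-cartesianProductWith⁺; ∈-cartesianProductWith⁻; ∈-applyUpTo⁺; ∈-applyUpTo⁻)
  open import Data.Product using (∃; ∃₂; proj₁; proj₂)
  open import Data.Sum using (_⊎_; inj₁; inj₂)
  open import Data.Empty using (⊥-elim)
  open import Data.Unit using (⊤; tt)
  open import Function using (_∘_; id)
  open import Function.Bundles using (mk⇔; Equivalence)
  open import Relation.Nullary using (¬_)
  open import Relation.Binary.PropositionalEquality

  module _ {A : Set} where

    AllPairs-map-local : ∀ {R S : A → A → Set} {xs} →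
                         (∀ {x y} → x ∈ xs → y ∈ xs → R x y → S x y) → AllPairs R xs → AllPairs S xs
    AllPairs-map-local R⇒S []         = []
    AllPairs-map-local R⇒S (Rx ∷ Rxs) =
      All.tabulate (λ y∈ → R⇒S (here refl) (there y∈) (All.lookup Rx y∈))
      ∷ AllPairs-map-local (λ x∈ y∈ → R⇒S (there x∈) (there y∈)) Rxs

    ++-split : ∀ (xs ys zs ws : List A) → xs ++ ys ≡ zs ++ ws →
               (∃ λ r → zs ≡ xs ++ r × ys ≡ r ++ ws) ⊎ (∃ λ r → xs ≡ zs ++ r × ws ≡ r ++ ys)
    ++-split []       ys zs       ws eq = inj₁ (zs , refl , eq)
    ++-split (x ∷ xs) ys []       ws eq = inj₂ (x ∷ xs , refl , sym eq)
    ++-split (x ∷ xs) ys (z ∷ zs) ws eq with List.∷-injective eq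
    ... | refl , eq′ with ++-split xs ys zs ws eq′
    ...   | inj₁ (r , refl , eq″) = inj₁ (r , refl , eq″)
    ...   | inj₂ (r , refl , eq″) = inj₂ (r , refl , eq″)

  module _ {A B : Set} where

    Unique-map⁺-local : ∀ {f : A → B} {xs} → (∀ {x y} → x ∈ xs → y ∈ xs → f x ≡ f y → x ≡ y) →
                        Unique xs → Unique (map f xs)
    Unique-map⁺-local inj xs! = AllPairs.map⁺ (AllPairs-map-local (λ x∈ y∈ x≢y → x≢y ∘ inj x∈ y∈) xs!)

    length-concatMap : ∀ (f : A → List B) xs → length (concatMap f xs) ≡ sum (map (length ∘ f) xs)
    length-concatMap f []       = refl
    length-concatMap f (x ∷ xs) = trans (List.length-++ (f x)) (cong (_+_ (length (f x))) (length-concatMap f xs))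

  module _ {A B C : Set} where

    Unique-cartesianProductWith⁺-local :
      ∀ (f : A → B → C) {xs ys} →
      (∀ {x x′ y y′} → x ∈ xs → x′ ∈ xs → y ∈ ys → y′ ∈ ys → f x y ≡ f x′ y′ → x ≡ x′ × y ≡ y′) →
      Unique xs → Unique ys → Unique (cartesianProductWith f xs ys)
    Unique-cartesianProductWith⁺-local f inj [] ys! = []
    Unique-cartesianProductWith⁺-local f {x ∷ xs} {ys} inj (x∉xs ∷ xs!) ys! = Unique.++⁺
      (Unique-map⁺-local (λ y∈ y′∈ → proj₂ ∘ inj (here refl) (here refl) y∈ y′∈) ys!)
      (Unique-cartesianProductWith⁺-local f (λ x∈ x′∈ → inj (there x∈) (there x′∈)) xs! ys!)
      disjoint
      where
      disjoint : Disjoint (map (f x) ys) (cartesianProductWith f xs ys)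
      disjoint (v∈map , v∈prod) with ∈-map⁻ (f x) v∈map | ∈-cartesianProductWith⁻ f xs ys v∈prod
      ... | y , y∈ , refl | x′ , y′ , x′∈ , y′∈ , eq =
        All.lookup x∉xs x′∈ (proj₁ (inj (here refl) (there x′∈) y∈ y′∈ eq))

    length-cartesianProductWith : ∀ (f : A → B → C) xs ys →
                                  length (cartesianProductWith f xs ys) ≡ length xs * length ys
    length-cartesianProductWith f []       ys = refl
    length-cartesianProductWith f (x ∷ xs) ys = trans (List.length-++ (map (f x) ys))
      (cong₂ _+_ (List.length-map (f x) ys) (length-cartesianProductWith f xs ys))

  -- The pattern of a path is a word describing its profile: `free` is a step at which no DU_k
  -- occurs, and `DU₁₊ j` is an occurrence of D U_{1+j}, which occupies two steps.
  data Block : Set where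
    free : Block
    DU₁₊ : ℕ → Block

  Word : Set
  Word = List Block

  DU₁₊-injective : ∀ {j j′} → DU₁₊ j ≡ DU₁₊ j′ → j ≡ j′
  DU₁₊-injective refl = refl

  weight : Word → ℕ
  weight []           = 0
  weight (free ∷ w)   = suc (weight w)
  weight (DU₁₊ j ∷ w) = suc (suc (weight w))

  -- A path with pattern w ending at height b starts at height at most top b w, with equality when
  -- all its free steps are D steps; Feasible b w says that in this highest path the D of every
  -- occurrence starts at height ≥ 1.
  top : ℕ → Word → ℕ
  top b []           = b
  top b (free ∷ w)   = suc (top b w)
  top b (DU₁₊ j ∷ w) = top b w ∸ j

  Feasible : ℕ → Word → Set
  Feasible b []           = ⊤
  Feasible b (free ∷ w)   = Feasible b w
  Feasible b (DU₁₊ j ∷ w) = Feasible b w × suc j ≤ top b w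

  weight-++ : ∀ w w′ → weight (w ++ w′) ≡ weight w + weight w′
  weight-++ []           w′ = refl
  weight-++ (free ∷ w)   w′ = cong suc (weight-++ w w′)
  weight-++ (DU₁₊ j ∷ w) w′ = cong (suc ∘ suc) (weight-++ w w′)

  top-++ : ∀ b w w′ → top b (w ++ w′) ≡ top (top b w′) w
  top-++ b []           w′ = refl
  top-++ b (free ∷ w)   w′ = cong suc (top-++ b w w′)
  top-++ b (DU₁₊ j ∷ w) w′ = cong (_∸ j) (top-++ b w w′)

  Feasible-++⁻ : ∀ b w w′ → Feasible b (w ++ w′) → Feasible b w′ × Feasible (top b w′) w
  Feasible-++⁻ b []           w′ ok         = ok , tt
  Feasible-++⁻ b (free ∷ w)   w′ ok         = Feasible-++⁻ b w w′ ok
  Feasible-++⁻ b (DU₁₊ j ∷ w) w′ (ok , j<t) =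
    proj₁ (Feasible-++⁻ b w w′ ok) , proj₂ (Feasible-++⁻ b w w′ ok) , subst (suc j ≤_) (top-++ b w w′) j<t

  Feasible-++⁺ : ∀ b w w′ → Feasible b w′ → Feasible (top b w′) w → Feasible b (w ++ w′)
  Feasible-++⁺ b []           w′ ok′ _           = ok′
  Feasible-++⁺ b (free ∷ w)   w′ ok′ ok          = Feasible-++⁺ b w w′ ok′ ok
  Feasible-++⁺ b (DU₁₊ j ∷ w) w′ ok′ (ok , j<t) =
    Feasible-++⁺ b w w′ ok′ ok , subst (suc j ≤_) (sym (top-++ b w w′)) j<t

  top-raise : ∀ c w → Feasible 0 w → top c w ≡ c + top 0 w
  top-raise c []           _          = sym (ℕP.+-identityʳ c)
  top-raise c (free ∷ w)   ok         = trans (cong suc (top-raise c w ok)) (sym (ℕP.+-suc c (top 0 w)))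
  top-raise c (DU₁₊ j ∷ w) (ok , j<t) =
    trans (cong (_∸ j) (top-raise c w ok)) (ℕP.+-∸-assoc c (ℕP.≤-trans (ℕP.n≤1+n j) j<t))

  Feasible-raise : ∀ c w → Feasible 0 w → Feasible c w
  Feasible-raise c []           _          = tt
  Feasible-raise c (free ∷ w)   ok         = Feasible-raise c w ok
  Feasible-raise c (DU₁₊ j ∷ w) (ok , j<t) =
    Feasible-raise c w ok , subst (suc j ≤_) (sym (top-raise c w ok)) (ℕP.≤-trans j<t (ℕP.m≤n+m (top 0 w) c))

  top-pos : ∀ b w → Feasible 0 (b ∷ w) → 1 ≤ top 0 (b ∷ w)
  top-pos free     w _          = s≤s z≤n
  top-pos (DU₁₊ j) w (_ , j<t) = ℕP.m+n≤o⇒m≤o∸n 1 j<t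

  weight-pos : ∀ w → 1 ≤ top 0 w → 1 ≤ weight w
  weight-pos (free ∷ w)   _ = s≤s z≤n
  weight-pos (DU₁₊ j ∷ w) _ = s≤s z≤n

  join : Word → Word → Word
  join w₁ w₂ = DU₁₊ (top 0 w₂) ∷ w₁ ++ w₂

  join-feasible : ∀ w₁ w₂ → Feasible 0 w₁ → 1 ≤ top 0 w₁ → Feasible 0 w₂ → Feasible 0 (join w₁ w₂)
  join-feasible w₁ w₂ ok₁ pos ok₂ =
    Feasible-++⁺ 0 w₁ w₂ ok₂ (Feasible-raise (top 0 w₂) w₁ ok₁) ,
    subst (suc (top 0 w₂) ≤_) (sym (trans (top-++ 0 w₁ w₂) (top-raise (top 0 w₂) w₁ ok₁)))
      (ℕP.m<m+n (top 0 w₂) pos)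

  decompose : ∀ x y w → Feasible 0 w → top 0 w ≡ suc (x + y) →
              ∃₂ λ w₁ w₂ → w ≡ w₁ ++ w₂ × Feasible 0 w₂ × top 0 w₂ ≡ x × Feasible 0 w₁ × top 0 w₁ ≡ suc y
  decompose x y       []           _  ()
  decompose x zero    (free ∷ w)   ok eq =
    free ∷ [] , w , refl , ok , trans (ℕP.suc-injective eq) (ℕP.+-identityʳ x) , tt , refl
  decompose x (suc y) (free ∷ w)   ok eq
    with decompose x y w ok (trans (ℕP.suc-injective eq) (ℕP.+-suc x y))
  ... | w₁ , w₂ , refl , ok₂ , t₂ , ok₁ , t₁ = free ∷ w₁ , w₂ , refl , ok₂ , t₂ , ok₁ , cong suc t₁
  decompose x y       (DU₁₊ j ∷ w) (ok , j<t) eq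
    with decompose x (y + j) w ok (begin
           top 0 w             ≡⟨ ℕP.m∸n+n≡m (ℕP.≤-trans (ℕP.n≤1+n j) j<t) ⟨
           top 0 w ∸ j + j     ≡⟨ cong (_+ j) eq ⟩
           suc (x + y) + j     ≡⟨ cong suc (ℕP.+-assoc x y j) ⟩
           suc (x + (y + j))   ∎)
    where open ≡-Reasoning
  ... | w₁ , w₂ , refl , ok₂ , t₂ , ok₁ , t₁ =
    DU₁₊ j ∷ w₁ , w₂ , refl , ok₂ , t₂ ,
    (ok₁ , subst (suc j ≤_) (sym t₁) (s≤s (ℕP.m≤n+m j y))) ,
    trans (cong (_∸ j) t₁) (ℕP.m+n∸n≡m (suc y) j)

  -- A nonempty feasible word raises the top of whatever it is prepended to.
  feasible-prefix-empty : ∀ r w → Feasible 0 r → top 0 (r ++ w) ≡ top 0 w → r ≡ []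
  feasible-prefix-empty []      w _  _  = refl
  feasible-prefix-empty (b ∷ r) w ok eq = ⊥-elim (ℕP.<⇒≢ (ℕP.m<m+n (top 0 w) (top-pos b r ok)) (begin
    top 0 w                   ≡⟨ eq ⟨
    top 0 (b ∷ r ++ w)        ≡⟨ top-++ 0 (b ∷ r) w ⟩
    top (top 0 w) (b ∷ r)     ≡⟨ top-raise (top 0 w) (b ∷ r) ok ⟩
    top 0 w + top 0 (b ∷ r)   ∎))
    where open ≡-Reasoning

  join-injective : ∀ {w₁ w₂ w₁′ w₂′} → Feasible 0 w₁ → Feasible 0 w₁′ →
                   join w₁ w₂ ≡ join w₁′ w₂′ → w₁ ≡ w₁′ × w₂ ≡ w₂′
  join-injective {w₁} {w₂} {w₁′} {w₂′} ok₁ ok₁′ eq with List.∷-injective eq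
  ... | top-eq , tail-eq with ++-split w₁ w₂ w₁′ w₂′ tail-eq
  ...   | inj₁ (r , refl , refl)
          with feasible-prefix-empty r w₂′ (proj₁ (Feasible-++⁻ 0 w₁ r ok₁′)) (DU₁₊-injective top-eq)
  ...     | refl = sym (List.++-identityʳ w₁) , refl
  join-injective {w₁} {w₂} {w₁′} {w₂′} ok₁ ok₁′ eq
        | top-eq , tail-eq | inj₂ (r , refl , refl)
          with feasible-prefix-empty r w₂ (proj₁ (Feasible-++⁻ 0 w₁′ r ok₁)) (sym (DU₁₊-injective top-eq))
  ...     | refl = List.++-identityʳ w₁′ , refl

  positivesBelow : ℕ → List ℕ
  positivesBelow m = drop 1 (upTo m)

  ∈-positivesBelow⁻ : ∀ m {k} → k ∈ positivesBelow m → 1 ≤ k × k < m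
  ∈-positivesBelow⁻ (suc m) k∈ with ∈-applyUpTo⁻ (id ∘ suc) k∈
  ... | i , i<m , refl = s≤s z≤n , s≤s i<m

  ∈-positivesBelow⁺ : ∀ {m k} → 1 ≤ k → k < m → k ∈ positivesBelow m
  ∈-positivesBelow⁺ {suc m} {suc k} _ (s≤s k<m) = ∈-applyUpTo⁺ (id ∘ suc) k<m

  positivesBelow-unique : ∀ m → Unique (positivesBelow m)
  positivesBelow-unique m = Unique.drop⁺ 1 (Unique.upTo⁺ m)

  joins : (ℕ → List Word) → ℕ → ℕ → List Word
  joins W m k = cartesianProductWith join (W k) (W (m ∸ 1 ∸ k))

  ∈-joins⁻ : ∀ W m {ks v} → v ∈ concatMap (joins W m) ks →
             ∃ λ k → k ∈ ks × ∃₂ λ w₁ w₂ → w₁ ∈ W k × w₂ ∈ W (m ∸ 1 ∸ k) × v ≡ join w₁ w₂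
  ∈-joins⁻ W m {ks} v∈ with find (∈-concatMap⁻ (joins W m) {ks} v∈)
  ... | k , k∈ , v∈k with ∈-cartesianProductWith⁻ join (W k) (W (m ∸ 1 ∸ k)) v∈k
  ...   | w₁ , w₂ , w₁∈ , w₂∈ , v≡ = k , k∈ , w₁ , w₂ , w₁∈ , w₂∈ , v≡

  -- The first argument is fuel; it only has to exceed the weight.
  feasibleWords : ℕ → ℕ → List Word
  feasibleWords zero    _       = []
  feasibleWords (suc f) zero    = [] ∷ []
  feasibleWords (suc f) (suc m) =
    map (free ∷_) (feasibleWords f m) ++ concatMap (joins (feasibleWords f) m) (positivesBelow m)

  join-weight : ∀ {m k} → k < m → suc (k + (m ∸ 1 ∸ k)) ≡ m
  join-weight {suc m} (s≤s k≤m) = cong suc (ℕP.m+[n∸m]≡n k≤m)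

  feasibleWords-sound : ∀ f m {w} → w ∈ feasibleWords f m → Feasible 0 w × weight w ≡ m
  feasibleWords-sound (suc f) zero    (here refl) = tt , refl
  feasibleWords-sound (suc f) (suc m) w∈ with ∈-++⁻ (map (free ∷_) (feasibleWords f m)) w∈
  ... | inj₁ w∈free with ∈-map⁻ (free ∷_) w∈free
  ...   | w , w∈ , refl = proj₁ (feasibleWords-sound f m w∈) , cong suc (proj₂ (feasibleWords-sound f m w∈))
  feasibleWords-sound (suc f) (suc m) w∈ | inj₂ w∈joins
    with ∈-joins⁻ (feasibleWords f) m {positivesBelow m} w∈joins
  ... | k , k∈ , w₁ , w₂ , w₁∈ , w₂∈ , refl =
    join-feasible w₁ w₂ ok₁ (top-pos-weight w₁ ok₁ (subst (1 ≤_) (sym weight₁) 1≤k)) ok₂ ,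
    cong suc (begin
      suc (weight (w₁ ++ w₂))       ≡⟨ cong suc (weight-++ w₁ w₂) ⟩
      suc (weight w₁ + weight w₂)   ≡⟨ cong₂ (λ a b → suc (a + b)) weight₁ weight₂ ⟩
      suc (k + (m ∸ 1 ∸ k))         ≡⟨ join-weight k<m ⟩
      m                             ∎)
    where
    open ≡-Reasoning
    1≤k : 1 ≤ k
    1≤k = proj₁ (∈-positivesBelow⁻ m k∈)
    k<m : k < m
    k<m = proj₂ (∈-positivesBelow⁻ m k∈)
    ok₁ : Feasible 0 w₁
    ok₁ = proj₁ (feasibleWords-sound f k w₁∈)
    weight₁ : weight w₁ ≡ k
    weight₁ = proj₂ (feasibleWords-sound f k w₁∈)
    ok₂ : Feasible 0 w₂
    ok₂ = proj₁ (feasibleWords-sound f (m ∸ 1 ∸ k) w₂∈)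
    weight₂ : weight w₂ ≡ m ∸ 1 ∸ k
    weight₂ = proj₂ (feasibleWords-sound f (m ∸ 1 ∸ k) w₂∈)
    top-pos-weight : ∀ w → Feasible 0 w → 1 ≤ weight w → 1 ≤ top 0 w
    top-pos-weight (b ∷ w) ok _ = top-pos b w ok

  m∸n∸o≤m : ∀ m n o → m ∸ n ∸ o ≤ m
  m∸n∸o≤m m n o = ℕP.≤-trans (ℕP.m∸n≤m (m ∸ n) o) (ℕP.m∸n≤m m n)

  feasibleWords-complete : ∀ f {w} → Feasible 0 w → weight w < f → w ∈ feasibleWords f (weight w)
  feasibleWords-complete (suc f) {[]}         _  _         = here refl
  feasibleWords-complete (suc f) {free ∷ w}   ok (s≤s w<f) =
    ∈-++⁺ˡ (∈-map⁺ (free ∷_) (feasibleWords-complete f ok w<f))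
  feasibleWords-complete (suc f) {DU₁₊ j ∷ w} (ok , j<t) (s≤s w<f)
    with decompose j (top 0 w ∸ suc j) w ok (sym (ℕP.m+[n∸m]≡n j<t))
  ... | w₁ , w₂ , refl , ok₂ , refl , ok₁ , top₁ =
    ∈-++⁺ʳ (map (free ∷_) (feasibleWords f (suc n)))
      (∈-concatMap⁺ (joins (feasibleWords f) (suc n)) (Any.map (λ { refl → join∈ }) k∈))
    where
    n k : ℕ
    n = weight (w₁ ++ w₂)
    k = weight w₁
    k≤n : k ≤ n
    k≤n = subst (k ≤_) (sym (weight-++ w₁ w₂)) (ℕP.m≤m+n k (weight w₂))
    k∈ : k ∈ positivesBelow (suc n)
    k∈ = ∈-positivesBelow⁺ (weight-pos w₁ (subst (1 ≤_) (sym top₁) (s≤s z≤n))) (s≤s k≤n)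
    w₂-weight : weight w₂ ≡ n ∸ k
    w₂-weight = sym (trans (cong (_∸ k) (weight-++ w₁ w₂)) (ℕP.m+n∸m≡n k (weight w₂)))
    n<f : n < f
    n<f = ℕP.<-trans (ℕP.n<1+n n) w<f
    join∈ : join w₁ w₂ ∈ joins (feasibleWords f) (suc n) k
    join∈ = ∈-cartesianProductWith⁺ join
      (feasibleWords-complete f ok₁ (ℕP.≤-<-trans k≤n n<f))
      (subst (λ i → w₂ ∈ feasibleWords f i) w₂-weight
        (feasibleWords-complete f ok₂ (ℕP.≤-<-trans (subst (_≤ n) (sym w₂-weight) (ℕP.m∸n≤m n k)) n<f)))

  feasibleWords-unique : ∀ f m → Unique (feasibleWords f m)
  feasibleWords-unique zero    m       = []
  feasibleWords-unique (suc f) zero    = [] ∷ []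
  feasibleWords-unique (suc f) (suc m) = Unique.++⁺
    (Unique.map⁺ List.∷-injectiveʳ (feasibleWords-unique f m))
    (Unique.concat⁺ (All.map⁺ (All.universal joins-unique (positivesBelow m)))
                    (AllPairs.map⁺ (AllPairs.map joins-disjoint (positivesBelow-unique m))))
    free-disjoint-joins
    where
    W : ℕ → List Word
    W = feasibleWords f
    feasible : ∀ {k w} → w ∈ W k → Feasible 0 w
    feasible {k} = proj₁ ∘ feasibleWords-sound f k
    joins-unique : ∀ k → Unique (joins W m k)
    joins-unique k = Unique-cartesianProductWith⁺-local join
      (λ w₁∈ w₁′∈ _ _ → join-injective (feasible w₁∈) (feasible w₁′∈))
      (feasibleWords-unique f k) (feasibleWords-unique f (m ∸ 1 ∸ k))
    joins-disjoint : ∀ {k k′} → k ≢ k′ → Disjoint (joins W m k) (joins W m k′)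
    joins-disjoint {k} {k′} k≢k′ (v∈ , v∈′)
      with ∈-cartesianProductWith⁻ join (W k) _ v∈ | ∈-cartesianProductWith⁻ join (W k′) _ v∈′
    ... | w₁ , _ , w₁∈ , _ , refl | w₁′ , _ , w₁′∈ , _ , eq = k≢k′ (begin
      k            ≡⟨ proj₂ (feasibleWords-sound f k w₁∈) ⟨
      weight w₁    ≡⟨ cong weight (proj₁ (join-injective (feasible w₁∈) (feasible w₁′∈) eq)) ⟩
      weight w₁′   ≡⟨ proj₂ (feasibleWords-sound f k′ w₁′∈) ⟩
      k′           ∎)
      where open ≡-Reasoning
    free-disjoint-joins : Disjoint (map (free ∷_) (W m)) (concatMap (joins W m) (positivesBelow m))
    free-disjoint-joins (v∈free , v∈joins)
      with ∈-map⁻ (free ∷_) v∈free | ∈-joins⁻ W m {positivesBelow m} v∈joins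
    ... | _ , _ , refl | _ , _ , _ , _ , _ , _ , ()

  feasibleWords-fuel : ∀ {f f′} m → m < f → m < f′ → feasibleWords f m ≡ feasibleWords f′ m
  feasibleWords-fuel {suc f} {suc f′} zero    _         _          = refl
  feasibleWords-fuel {suc f} {suc f′} (suc m) (s≤s m<f) (s≤s m<f′) =
    cong₂ _++_ (cong (map (free ∷_)) (feasibleWords-fuel m m<f m<f′))
               (cong concat (List.map-cong-local (All.tabulate same-joins)))
    where
    same-joins : ∀ {k} → k ∈ positivesBelow m → joins (feasibleWords f) m k ≡ joins (feasibleWords f′) m k
    same-joins {k} k∈ = cong₂ (cartesianProductWith join)
      (feasibleWords-fuel k (ℕP.<-trans k<m m<f) (ℕP.<-trans k<m m<f′))
      (feasibleWords-fuel (m ∸ 1 ∸ k) (ℕP.≤-<-trans (m∸n∸o≤m m 1 k) m<f) (ℕP.≤-<-trans (m∸n∸o≤m m 1 k) m<f′))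
      where
      k<m : k < m
      k<m = proj₂ (∈-positivesBelow⁻ m k∈)

  words : ℕ → List Word
  words m = feasibleWords (suc m) m

  count : ℕ → ℕ
  count m = length (words m)

  count-isA : IsA count
  count-isA = refl , λ m → begin
    length (map (free ∷_) (words m) ++ concatMap (joinsₘ m) (positivesBelow m))
      ≡⟨ List.length-++ (map (free ∷_) (words m)) ⟩
    length (map (free ∷_) (words m)) + length (concatMap (joinsₘ m) (positivesBelow m))
      ≡⟨ cong₂ _+_ (List.length-map (free ∷_) (words m)) (length-concatMap (joinsₘ m) (positivesBelow m)) ⟩
    count m + sum (map (length ∘ joinsₘ m) (positivesBelow m))
      ≡⟨ cong (λ ns → count m + sum ns) (List.map-cong-local (All.tabulate (length-joins m))) ⟩
    count m + sum1to m (λ k → count k * count (m ∸ 1 ∸ k)) ∎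
    where
    open ≡-Reasoning
    joinsₘ : ℕ → ℕ → List Word
    joinsₘ m = joins (feasibleWords (suc m)) m
    length-joins : ∀ m {k} → k ∈ positivesBelow m → length (joinsₘ m k) ≡ count k * count (m ∸ 1 ∸ k)
    length-joins m {k} k∈ = trans
      (length-cartesianProductWith join (feasibleWords (suc m) k) (feasibleWords (suc m) (m ∸ 1 ∸ k)))
      (cong₂ (λ xs ys → length xs * length ys)
      (feasibleWords-fuel k (ℕP.<-trans (proj₂ (∈-positivesBelow⁻ m k∈)) (ℕP.n<1+n m)) (ℕP.n<1+n k))
      (feasibleWords-fuel (m ∸ 1 ∸ k) (s≤s (m∸n∸o≤m m 1 k)) (ℕP.n<1+n _)))

  IsA-unique : ∀ {a b} → IsA a → IsA b → ∀ m → a m ≡ b m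
  IsA-unique {a} {b} (a₀ , a-suc) (b₀ , b-suc) = <-rec (λ m → a m ≡ b m) step
    where
    step : ∀ m → (∀ {k} → k < m → a k ≡ b k) → a m ≡ b m
    step zero    _  = trans a₀ (sym b₀)
    step (suc m) ih = begin
      a (suc m)
        ≡⟨ a-suc m ⟩
      a m + sum1to m (λ k → a k * a (m ∸ 1 ∸ k))
        ≡⟨ cong₂ (λ x ns → x + sum ns) (ih (ℕP.n<1+n m)) (List.map-cong-local (All.tabulate same-product)) ⟩
      b m + sum1to m (λ k → b k * b (m ∸ 1 ∸ k))
        ≡⟨ b-suc m ⟨
      b (suc m) ∎
      where
      open ≡-Reasoning
      same-product : ∀ {k} → k ∈ positivesBelow m → a k * a (m ∸ 1 ∸ k) ≡ b k * b (m ∸ 1 ∸ k)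
      same-product {k} k∈ = cong₂ _*_ (ih (ℕP.<-trans (proj₂ (∈-positivesBelow⁻ m k∈)) (ℕP.n<1+n m)))
                                      (ih (s≤s (m∸n∸o≤m m 1 k)))

  -- -[1+ 0 ] is D and + k is U_k, where U₀ = F correctly gives no occurrence.
  DU-index : ℤ → List ℤ → ℕ
  DU-index -[1+ 0 ] (+ k ∷ _) = k
  DU-index _        _         = 0

  profile : List ℤ → List ℕ
  profile []      = []
  profile (s ∷ r) = DU-index s r ∷ profile r

  length-profile : ∀ p → length (profile p) ≡ length p
  length-profile []      = refl
  length-profile (s ∷ p) = cong suc (length-profile p)

  entry : ℕ → List ℕ → ℕ
  entry i       []       = 0
  entry zero    (x ∷ xs) = x
  entry (suc i) (x ∷ xs) = entry i xs

  entry-ext : ∀ xs ys → length xs ≡ length ys → (∀ i → entry i xs ≡ entry i ys) → xs ≡ ys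
  entry-ext []       []       _   _  = refl
  entry-ext (x ∷ xs) (y ∷ ys) len eq =
    cong₂ _∷_ (eq 0) (entry-ext xs ys (ℕP.suc-injective len) (eq ∘ suc))

  OccAt⇒entry : ∀ {k i} p → OccAt (suc k) (suc i) p → entry i (profile p) ≡ suc k
  OccAt⇒entry .(pre ++ -[1+ 0 ] ∷ + _ ∷ post) (pre , post , refl , refl) = go pre
    where
    go : ∀ pre → entry (length pre) (profile (pre ++ -[1+ 0 ] ∷ + _ ∷ post)) ≡ _
    go []        = refl
    go (s ∷ pre) = go pre

  entry⇒OccAt : ∀ p i {k} → entry i (profile p) ≡ suc k → OccAt (suc k) (suc i) p
  entry⇒OccAt (-[1+ 0 ] ∷ + suc k ∷ r) zero    refl = [] , r , refl , refl
  entry⇒OccAt (+ n ∷ r)                zero    ()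
  entry⇒OccAt (-[1+ suc n ] ∷ r)       zero    ()
  entry⇒OccAt (-[1+ 0 ] ∷ [])          zero    ()
  entry⇒OccAt (-[1+ 0 ] ∷ + 0 ∷ r)     zero    ()
  entry⇒OccAt (-[1+ 0 ] ∷ -[1+ n ] ∷ r) zero   ()
  entry⇒OccAt (s ∷ r)                  (suc i) eq with entry⇒OccAt r i eq
  ... | pre , post , refl , refl = s ∷ pre , post , refl , refl

  profile-≡⇒DUEquiv : ∀ p q → profile p ≡ profile q → DUEquiv p q
  profile-≡⇒DUEquiv p q eq (suc k) _ zero    = mk⇔ (λ { (_ , _ , _ , ()) }) (λ { (_ , _ , _ , ()) })
  profile-≡⇒DUEquiv p q eq (suc k) _ (suc i) =
    mk⇔ (λ o → entry⇒OccAt q i (trans (cong (entry i) (sym eq)) (OccAt⇒entry p o)))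
        (λ o → entry⇒OccAt p i (trans (cong (entry i) eq) (OccAt⇒entry q o)))

  DUEquiv⇒profile-≡ : ∀ p q → length p ≡ length q → DUEquiv p q → profile p ≡ profile q
  DUEquiv⇒profile-≡ p q len equiv = entry-ext (profile p) (profile q)
    (trans (length-profile p) (trans len (sym (length-profile q)))) same-entry
    where
    same-entry : ∀ i → entry i (profile p) ≡ entry i (profile q)
    same-entry i with entry i (profile p) in eqp
    ... | suc k = sym (OccAt⇒entry q (Equivalence.to (equiv (suc k) (s≤s z≤n) (suc i)) (entry⇒OccAt p i eqp)))
    ... | zero with entry i (profile q) in eqq
    ...   | zero  = refl
    ...   | suc k = trans (sym eqp)
                      (OccAt⇒entry p (Equivalence.from (equiv (suc k) (s≤s z≤n) (suc i)) (entry⇒OccAt q i eqq)))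

  profileOf : Word → List ℕ
  profileOf []           = []
  profileOf (free ∷ w)   = 0 ∷ profileOf w
  profileOf (DU₁₊ j ∷ w) = suc j ∷ 0 ∷ profileOf w

  length-profileOf : ∀ w → length (profileOf w) ≡ weight w
  length-profileOf []           = refl
  length-profileOf (free ∷ w)   = cong suc (length-profileOf w)
  length-profileOf (DU₁₊ j ∷ w) = cong (suc ∘ suc) (length-profileOf w)

  profileOf-injective : ∀ w w′ → profileOf w ≡ profileOf w′ → w ≡ w′
  profileOf-injective []           []             _  = refl
  profileOf-injective (free ∷ w)   (free ∷ w′)    eq = cong (free ∷_) (profileOf-injective w w′ (List.∷-injectiveʳ eq))
  profileOf-injective (DU₁₊ j ∷ w) (DU₁₊ j′ ∷ w′) eq with List.∷-injective eq
  ... | refl , eq′ = cong (DU₁₊ j ∷_) (profileOf-injective w w′ (List.∷-injectiveʳ eq′))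
  profileOf-injective []           (free ∷ _)     ()
  profileOf-injective []           (DU₁₊ _ ∷ _)   ()
  profileOf-injective (free ∷ _)   []             ()
  profileOf-injective (DU₁₊ _ ∷ _) []             ()
  profileOf-injective (free ∷ _)   (DU₁₊ _ ∷ _)   ()
  profileOf-injective (DU₁₊ _ ∷ _) (free ∷ _)     ()

  blocks : List ℤ → Word
  blocks []                       = []
  blocks (-[1+ 0 ] ∷ + suc k ∷ r) = DU₁₊ k ∷ blocks r
  blocks (_ ∷ r)                  = free ∷ blocks r

  profileOf-blocks : ∀ p → profileOf (blocks p) ≡ profile p
  profileOf-blocks []                         = refl
  profileOf-blocks (-[1+ 0 ] ∷ + suc k ∷ r)   = cong (λ ns → suc k ∷ 0 ∷ ns) (profileOf-blocks r)
  profileOf-blocks (+ n ∷ r)                  = cong (0 ∷_) (profileOf-blocks r)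
  profileOf-blocks (-[1+ suc n ] ∷ r)         = cong (0 ∷_) (profileOf-blocks r)
  profileOf-blocks (-[1+ 0 ] ∷ [])            = refl
  profileOf-blocks (-[1+ 0 ] ∷ + 0 ∷ r)       = cong (0 ∷_) (profileOf-blocks (+ 0 ∷ r))
  profileOf-blocks (-[1+ 0 ] ∷ -[1+ n ] ∷ r)  = cong (0 ∷_) (profileOf-blocks (-[1+ n ] ∷ r))

  weight-blocks : ∀ p → weight (blocks p) ≡ length p
  weight-blocks p = begin
    weight (blocks p)               ≡⟨ length-profileOf (blocks p) ⟨
    length (profileOf (blocks p))   ≡⟨ cong length (profileOf-blocks p) ⟩
    length (profile p)              ≡⟨ length-profile p ⟩
    length p                        ∎
    where open ≡-Reasoning

  blocks-feasible : ∀ h p → PathFrom (+ h) p → Feasible 0 (blocks p) × h ≤ top 0 (blocks p)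
  blocks-feasible .0 [] refl = tt , z≤n
  blocks-feasible h (+ n ∷ r) (_ , _ , path) with blocks-feasible (h + n) r path
  ... | ok , h+n≤t = ok , ℕP.≤-trans (ℕP.m≤m+n h n) (ℕP.m≤n⇒m≤1+n h+n≤t)
  blocks-feasible h       (-[1+ suc n ] ∷ r) (ℤ.-≤- () , _)
  blocks-feasible zero    (-[1+ 0 ] ∷ r)     (_ , () , _)
  blocks-feasible (suc .0) (-[1+ 0 ] ∷ [])   (_ , _ , refl) = tt , s≤s z≤n
  blocks-feasible (suc h) (-[1+ 0 ] ∷ + 0 ∷ r) (_ , _ , path) with blocks-feasible h (+ 0 ∷ r) path
  ... | ok , h≤t = ok , s≤s h≤t
  blocks-feasible (suc h) (-[1+ 0 ] ∷ + suc k ∷ r) (_ , _ , _ , _ , path) with blocks-feasible (h + suc k) r path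
  ... | ok , h+1+k≤t =
    (ok , ℕP.≤-trans (ℕP.m≤n+m (suc k) h) h+1+k≤t) ,
    ℕP.m+n≤o⇒m≤o∸n (suc h) (subst (_≤ top 0 (blocks r)) (ℕP.+-suc h k) h+1+k≤t)
  blocks-feasible (suc h) (-[1+ 0 ] ∷ -[1+ n ] ∷ r) (_ , _ , path) with blocks-feasible h (-[1+ n ] ∷ r) path
  ... | ok , h≤t = ok , s≤s h≤t

  -- A path from height h ≥ 1 with pattern w: free steps are D steps, except that a free step at
  -- height 1 other than the last is an F step, so that every occurrence starts at height ≥ 1.
  realise : ℕ → Word → List ℤ
  realise h             []             = []
  realise h             (free ∷ [])    = -[1+ 0 ] ∷ []
  realise (suc (suc h)) (free ∷ b ∷ w) = -[1+ 0 ] ∷ realise (suc h) (b ∷ w)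
  realise h             (free ∷ b ∷ w) = + 0 ∷ realise h (b ∷ w)
  realise h             (DU₁₊ j ∷ w)   = -[1+ 0 ] ∷ + suc j ∷ realise (pred h + suc j) w

  DU-index-realise : ∀ h w → DU-index -[1+ 0 ] (realise h w) ≡ 0
  DU-index-realise h             []             = refl
  DU-index-realise h             (free ∷ [])    = refl
  DU-index-realise zero          (free ∷ b ∷ w) = refl
  DU-index-realise (suc zero)    (free ∷ b ∷ w) = refl
  DU-index-realise (suc (suc h)) (free ∷ b ∷ w) = refl
  DU-index-realise h             (DU₁₊ j ∷ w)   = refl

  profile-realise : ∀ h w → profile (realise h w) ≡ profileOf w
  profile-realise h             []             = refl
  profile-realise h             (free ∷ [])    = refl
  profile-realise zero          (free ∷ b ∷ w) = cong (0 ∷_) (profile-realise zero (b ∷ w))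
  profile-realise (suc zero)    (free ∷ b ∷ w) = cong (0 ∷_) (profile-realise (suc zero) (b ∷ w))
  profile-realise (suc (suc h)) (free ∷ b ∷ w) =
    cong₂ _∷_ (DU-index-realise (suc h) (b ∷ w)) (profile-realise (suc h) (b ∷ w))
  profile-realise h             (DU₁₊ j ∷ w)   = cong (λ ns → suc j ∷ 0 ∷ ns) (profile-realise (pred h + suc j) w)

  realise-path : ∀ h w → Feasible 0 w → 1 ≤ h → h ≤ top 0 w → PathFrom (+ h) (realise h w)
  realise-path (suc .0) (free ∷ []) _ _ (s≤s z≤n) = ℤ.-≤- z≤n , ℤ.+≤+ z≤n , refl
  realise-path (suc zero) (free ∷ b ∷ w) ok _ _ =
    ℤ.-≤+ , ℤ.+≤+ z≤n , realise-path 1 (b ∷ w) ok (s≤s z≤n) (top-pos b w ok)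
  realise-path (suc (suc h)) (free ∷ b ∷ w) ok _ (s≤s h<t) =
    ℤ.-≤- z≤n , ℤ.+≤+ z≤n , realise-path (suc h) (b ∷ w) ok (s≤s z≤n) h<t
  realise-path (suc h) (DU₁₊ j ∷ w) (ok , j<t) _ h≤t =
    ℤ.-≤- z≤n , ℤ.+≤+ z≤n , ℤ.-≤+ , ℤ.+≤+ z≤n ,
    realise-path (h + suc j) w ok (ℕP.≤-trans (s≤s z≤n) (ℕP.m≤n+m (suc j) h)) (begin
      h + suc j         ≡⟨ ℕP.+-suc h j ⟩
      suc h + j         ≤⟨ ℕP.+-monoˡ-≤ j h≤t ⟩
      top 0 w ∸ j + j   ≡⟨ ℕP.m∸n+n≡m (ℕP.≤-trans (ℕP.n≤1+n j) j<t) ⟩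
      top 0 w           ∎)
    where open ℕP.≤-Reasoning

  -- A path cannot start with D, so the pattern of a nonempty path begins with a free step.
  representative : Word → List ℤ
  representative []      = + 0 ∷ []
  representative (b ∷ w) = + 1 ∷ realise 1 (b ∷ w)

  profile-representative : ∀ w → profile (representative w) ≡ profileOf (free ∷ w)
  profile-representative []      = refl
  profile-representative (b ∷ w) = cong (0 ∷_) (profile-realise 1 (b ∷ w))

  representative-Luk : ∀ w → Feasible 0 w → Luk (suc (weight w)) (representative w)
  representative-Luk w ok = length-representative , path w ok
    where
    length-representative : length (representative w) ≡ suc (weight w)
    length-representative = begin
      length (representative w)             ≡⟨ length-profile (representative w) ⟨
      length (profile (representative w))   ≡⟨ cong length (profile-representative w) ⟩
      suc (length (profileOf w))            ≡⟨ cong suc (length-profileOf w) ⟩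
      suc (weight w)                        ∎
      where open ≡-Reasoning
    path : ∀ w → Feasible 0 w → PathFrom (+ 0) (representative w)
    path []      _  = ℤ.-≤+ , ℤ.+≤+ z≤n , refl
    path (b ∷ w) ok = ℤ.-≤+ , ℤ.+≤+ z≤n , realise-path 1 (b ∷ w) ok (s≤s z≤n) (top-pos b w ok)

  u : ℕ → ℕ
  u zero    = 1
  u (suc m) = count m

  classes : ∀ n → NumClasses n (u n)
  classes zero    =
    ([] ∷ []) , refl , ((refl , refl) ∷ []) , ([] ∷ []) , λ { [] _ → here (λ _ _ _ → mk⇔ id id) }
  classes (suc m) =
    map representative (words m) ,
    List.length-map representative (words m) ,
    All.map⁺ (All.tabulate λ w∈ →
      subst (λ n → Luk (suc n) _) (weight≡m w∈) (representative-Luk _ (feasible w∈))) ,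
    AllPairs.map⁺ (AllPairs-map-local inequivalent (feasibleWords-unique (suc m) m)) ,
    cover
    where
    feasible : ∀ {w} → w ∈ words m → Feasible 0 w
    feasible = proj₁ ∘ feasibleWords-sound (suc m) m
    weight≡m : ∀ {w} → w ∈ words m → weight w ≡ m
    weight≡m = proj₂ ∘ feasibleWords-sound (suc m) m
    inequivalent : ∀ {w w′} → w ∈ words m → w′ ∈ words m → w ≢ w′ →
                   ¬ DUEquiv (representative w) (representative w′)
    inequivalent {w} {w′} w∈ w′∈ w≢w′ equiv =
      w≢w′ (List.∷-injectiveʳ (profileOf-injective (free ∷ w) (free ∷ w′) (begin
        profileOf (free ∷ w)          ≡⟨ profile-representative w ⟨
        profile (representative w)    ≡⟨ DUEquiv⇒profile-≡ _ _ same-length equiv ⟩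
        profile (representative w′)   ≡⟨ profile-representative w′ ⟩
        profileOf (free ∷ w′)         ∎)))
      where
      open ≡-Reasoning
      same-length : length (representative w) ≡ length (representative w′)
      same-length = trans (proj₁ (representative-Luk w (feasible w∈)))
                          (trans (cong suc (trans (weight≡m w∈) (sym (weight≡m w′∈))))
                                 (sym (proj₁ (representative-Luk w′ (feasible w′∈)))))
    cover : ∀ p → Luk (suc m) p → Any (DUEquiv p) (map representative (words m))
    cover (+ n ∷ r)          (len , path) = Any.map (λ { refl → equiv }) (∈-map⁺ representative w∈)
      where
      w : Word
      w = blocks r
      weight≡ : weight w ≡ m
      weight≡ = trans (weight-blocks r) (ℕP.suc-injective len)
      w∈ : w ∈ words m
      w∈ = subst (λ k → w ∈ feasibleWords (suc m) k) weight≡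
        (feasibleWords-complete (suc m) (proj₁ (blocks-feasible 0 (+ n ∷ r) path))
                                      (s≤s (ℕP.≤-reflexive weight≡)))
      equiv : DUEquiv (+ n ∷ r) (representative w)
      equiv = profile-≡⇒DUEquiv _ _ (trans (sym (profileOf-blocks (+ n ∷ r))) (sym (profile-representative w)))
    cover (-[1+ 0 ] ∷ r)     (_ , _ , () , _)
    cover (-[1+ suc n ] ∷ r) (_ , ℤ.-≤- () , _)

open PowerSeries using (generating-function)
open DUClasses using (u; classes; count; count-isA; IsA-unique)

theorem13 : Σ (ℕ → ℕ) λ u →
    (∀ n → NumClasses n (u n)) ×
    GFIdentity u ×
    (u 0 ≡ 1) × (u 1 ≡ 1) × (u 2 ≡ 1) ×
    (∀ (a : ℕ → ℕ) → IsA a → ∀ n → 3 ≤ n → u n ≡ a (n ∸ 1))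
theorem13 =
  u , classes , generating-function count count-isA u refl (λ _ → refl) , refl , refl , refl ,
  λ { a isA (suc m) _ → IsA-unique count-isA isA m }
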